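{- Let $Q=(U,\Omega,r)$ be a multimatroid, let $X$ be a separator of $Q$, and let $A$ be a subtransversal of $\Omega$ such that $A\subseteq X$ and $A$ meets every skew class contained in $X$. Then $Q|A$ is the multimatroid with ground set $U-X$, whose skew classes are the skew classes of $Q$ disjoint from $X$, and whose rank function is the restriction of $r$ to subtransversals contained in $U-X$.
   Context: A multimatroid $Q=(U,\Omega,r)$ consists of a finite set $U$, a partition $\Omega$ of $U$ into skew classes, and a function $r$ from the set of subtransversals (sets meeting each skew class in at most one element) to the non-negative integers satisfying: (1) $r(\emptyset)=0$; (2) $r(A)\le r(A\cup x)\le r(A)+1$ whenever $x$ lies in a skew class avoiding the subtransversal $A$; (3) $r(A)+r(B)\ge r(A\cup B)+r(A\cap B)$ whenever $A\cup B$ is a subtransversal; (4) $r(A\cup x)-r(A)+r(A\cup y)-r(A)\ge 1$ whenever $x\neq y$ lie in a skew class avoiding the subtransversal $A$. For a subtransversal $A$, $Q|A$ is the multimatroid whose skew classes are those of $Q$ disjoint from $A$, with ground set their union and rank function $S\mapsto r(S\cup A)-r(A)$. A separator of $Q$ is a union $X$ of skew classes such that $r(S)=r(S\cap X)+r(S-X)$ for every subtransversal $S$. -}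

module Defs where

open import Data.Nat using (ℕ; suc; _+_; _∸_; _≤_)
open import Data.Fin using (Fin)
open import Data.Fin.Subset public using (Subset; _∈_; _∉_; _⊆_; _∪_; _∩_; _─_; ∁; ⁅_⁆)
open import Data.Product using (Σ; ∃; _×_; _,_)
open import Relation.Binary.PropositionalEquality using (_≡_)
open import Relation.Nullary using (¬_)

-- Ground set U = Fin n; the partition Ω into skew classes is given by a
-- surjective labelling  cls : Fin n → Fin k  (class ω = cls ⁻¹(ω), nonempty).

module _ {n k : ℕ} (cls : Fin n → Fin k) where

  IsSubtransversal : Subset n → Set
  IsSubtransversal S = ∀ x y → x ∈ S → y ∈ S → cls x ≡ cls y → x ≡ y

  ClassAvoids : Subset n → Fin n → Set
  ClassAvoids A x = ∀ y → cls y ≡ cls x → y ∉ A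

-- A multimatroid on ground set Fin n with k skew classes.
-- The rank function is given on all subsets but only its values on
-- subtransversals are constrained (and used).
record Multimatroid (n k : ℕ) : Set where
  field
    cls      : Fin n → Fin k
    cls-surj : ∀ (ω : Fin k) → ∃ λ u → cls u ≡ ω
    r        : Subset n → ℕ
    r-empty  : r Data.Fin.Subset.⊥ ≡ 0
    r-unit   : ∀ A x → IsSubtransversal cls A → ClassAvoids cls A x →
               (r A ≤ r (A ∪ ⁅ x ⁆)) × (r (A ∪ ⁅ x ⁆) ≤ suc (r A))
    r-submod : ∀ A B → IsSubtransversal cls (A ∪ B) →
               r (A ∪ B) + r (A ∩ B) ≤ r A + r B
    r-skew   : ∀ A x y → IsSubtransversal cls A → ¬ (x ≡ y) → cls x ≡ cls y →
               ClassAvoids cls A x →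
               1 ≤ (r (A ∪ ⁅ x ⁆) ∸ r A) + (r (A ∪ ⁅ y ⁆) ∸ r A)

module _ {n k : ℕ} (Q : Multimatroid n k) where
  open Multimatroid Q

  IsUnionOfClasses : Subset n → Set
  IsUnionOfClasses X = ∀ u v → cls u ≡ cls v → u ∈ X → v ∈ X

  IsSeparator : Subset n → Set
  IsSeparator X = IsUnionOfClasses X ×
    (∀ S → IsSubtransversal cls S → r S ≡ r (S ∩ X) + r (S ─ X))

  ClassDisjoint : Subset n → Fin k → Set
  ClassDisjoint Y ω = ∀ u → cls u ≡ ω → u ∉ Y

  ClassContained : Subset n → Fin k → Set
  ClassContained Y ω = ∀ u → cls u ≡ ω → u ∈ Y

  -- Minor Q|A (for a subtransversal A):
  --   skew classes: the classes of Q disjoint from A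
  MinorClass : Subset n → Fin k → Set
  MinorClass A ω = ClassDisjoint A ω
  InMinorGround : Subset n → Fin n → Set
  InMinorGround A u = MinorClass A (cls u)
  minorRank : Subset n → Subset n → ℕ
  minorRank A S = r (S ∪ A) ∸ r A

module Submission where

-- Because X is a union of skew
-- classes, a skew class is either contained in X or disjoint from it; the
-- classes contained in X are exactly those hit by A, so the classes of Q|A
-- (those disjoint from A) are exactly the classes disjoint from X, and the
-- ground set of Q|A is U − X.  For the rank, take a subtransversal S ⊆ U − X:
-- S ∪ A is again a subtransversal (S and A live in disjoint sets of classes),
-- its parts inside and outside X are A and S, so the separator identity gives
-- r(S ∪ A) = r(A) + r(S), i.e. the rank r(S ∪ A) − r(A) of S in Q|A is r(S).

open import Defs
open import Data.Nat using (ℕ; _+_; _∸_)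
open import Data.Nat.Properties using (m+n∸m≡n)
open import Data.Fin using (Fin)
open import Data.Fin.Subset using (outside; inside)
open import Data.Fin.Subset.Properties
  using (⊆-antisym; x∈p∪q⁺; x∈p∪q⁻; x∈p∩q⁺; x∈p∩q⁻; x∈p∧x∉q⇒x∈p─q; p─q⊆p; x∈∁p⇒x∉p)
open import Data.Product using (∃; _×_; _,_)
open import Data.Sum using (inj₁; inj₂; [_,_])
open import Data.Vec using (_∷_)
open import Data.Vec.Base using (here; there)
open import Data.Empty using (⊥-elim)
open import Function.Bundles using (_⇔_; mk⇔)
open import Relation.Binary.PropositionalEquality using (_≡_; refl; sym; trans; cong; cong₂)

x∈p─q⇒x∉q : ∀ {n} {x : Fin n} (p q : Subset n) → x ∈ p ─ q → x ∉ q
x∈p─q⇒x∉q (_      ∷ p) (outside ∷ q) (there x∈p─q) (there x∈q) = x∈p─q⇒x∉q p q x∈p─q x∈q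
x∈p─q⇒x∉q (_      ∷ p) (inside  ∷ q) (there x∈p─q) (there x∈q) = x∈p─q⇒x∉q p q x∈p─q x∈q
x∈p─q⇒x∉q (inside ∷ p) (outside ∷ q) here ()

module SplitAlong {n : ℕ} {S A X : Subset n} (S⊆∁X : S ⊆ ∁ X) (A⊆X : A ⊆ X) where

  ∉X : ∀ {x} → x ∈ S → x ∉ X
  ∉X x∈S = x∈∁p⇒x∉p (S⊆∁X x∈S)

  inside-part : (S ∪ A) ∩ X ≡ A
  inside-part = ⊆-antisym to (λ x∈A → x∈p∩q⁺ (x∈p∪q⁺ (inj₂ x∈A) , A⊆X x∈A))
    where
    to : (S ∪ A) ∩ X ⊆ A
    to x∈ with x∈p∩q⁻ (S ∪ A) X x∈
    ... | x∈S∪A , x∈X = [ (λ x∈S → ⊥-elim (∉X x∈S x∈X)) , (λ x∈A → x∈A) ] (x∈p∪q⁻ S A x∈S∪A)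

  outside-part : (S ∪ A) ─ X ≡ S
  outside-part = ⊆-antisym to (λ x∈S → x∈p∧x∉q⇒x∈p─q (x∈p∪q⁺ (inj₁ x∈S)) (∉X x∈S))
    where
    to : (S ∪ A) ─ X ⊆ S
    to x∈ = [ (λ x∈S → x∈S) , (λ x∈A → ⊥-elim (x∈p─q⇒x∉q (S ∪ A) X x∈ (A⊆X x∈A))) ]
              (x∈p∪q⁻ S A (p─q⊆p (S ∪ A) X x∈))

module _ {n k : ℕ} (Q : Multimatroid n k) where
  open Multimatroid Q

  classDisjoint⇔∉ : ∀ {X} → IsUnionOfClasses Q X → ∀ u → ClassDisjoint Q X (cls u) ⇔ u ∉ X
  classDisjoint⇔∉ unionX u =
    mk⇔ (λ disj → disj u refl) (λ u∉X v clsv≡clsu v∈X → u∉X (unionX v u clsv≡clsu v∈X))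

  -- If A ⊆ X, X is a union of classes and A meets every class contained in X,
  -- then a class avoids A exactly when it avoids X: a class meeting X is
  -- contained in X and hence meets A.
  avoidsA⇔avoidsX : ∀ {X A} → IsUnionOfClasses Q X → A ⊆ X →
    (∀ ω → ClassContained Q X ω → ∃ λ a → cls a ≡ ω × a ∈ A) →
    ∀ ω → ClassDisjoint Q A ω ⇔ ClassDisjoint Q X ω
  avoidsA⇔avoidsX {X} {A} unionX A⊆X meetsA ω = mk⇔ to (λ disjX u clsu≡ω u∈A → disjX u clsu≡ω (A⊆X u∈A))
    where
    to : ClassDisjoint Q A ω → ClassDisjoint Q X ω
    to disjA u clsu≡ω u∈X with meetsA ω (λ v clsv≡ω → unionX u v (trans clsu≡ω (sym clsv≡ω)) u∈X)
    ... | a , clsa≡ω , a∈A = disjA a clsa≡ω a∈A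

  -- Subtransversals on the two sides of a union of classes combine into a
  -- subtransversal: elements from different sides lie in different classes.
  ∪-subtransversal : ∀ {X S A} → IsUnionOfClasses Q X →
    IsSubtransversal cls S → IsSubtransversal cls A → S ⊆ ∁ X → A ⊆ X →
    IsSubtransversal cls (S ∪ A)
  ∪-subtransversal {X} {S} {A} unionX transS transA S⊆∁X A⊆X x y x∈ y∈ clsx≡clsy
    with x∈p∪q⁻ S A x∈ | x∈p∪q⁻ S A y∈
  ... | inj₁ x∈S | inj₁ y∈S = transS x y x∈S y∈S clsx≡clsy
  ... | inj₂ x∈A | inj₂ y∈A = transA x y x∈A y∈A clsx≡clsy
  ... | inj₁ x∈S | inj₂ y∈A = ⊥-elim (x∈∁p⇒x∉p (S⊆∁X x∈S) (unionX y x (sym clsx≡clsy) (A⊆X y∈A)))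
  ... | inj₂ x∈A | inj₁ y∈S = ⊥-elim (x∈∁p⇒x∉p (S⊆∁X y∈S) (unionX x y clsx≡clsy (A⊆X x∈A)))

  minorRank-across-separator : ∀ {X A} → IsSeparator Q X → IsSubtransversal cls A → A ⊆ X →
    ∀ S → IsSubtransversal cls S → S ⊆ ∁ X → minorRank Q A S ≡ r S
  minorRank-across-separator {X} {A} (unionX , split) transA A⊆X S transS S⊆∁X =
    trans (cong (_∸ r A) rank-split) (m+n∸m≡n (r A) (r S))
    where
    open SplitAlong S⊆∁X A⊆X
    rank-split : r (S ∪ A) ≡ r A + r S
    rank-split = trans (split (S ∪ A) (∪-subtransversal unionX transS transA S⊆∁X A⊆X))
                       (cong₂ _+_ (cong r inside-part) (cong r outside-part))

lemma11 : ∀ {n k} (Q : Multimatroid n k) (X A : Subset n) →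
    IsSeparator Q X →
    IsSubtransversal (Multimatroid.cls Q) A →
    A ⊆ X →
    (∀ (ω : Fin k) → ClassContained Q X ω →
    ∃ λ a → Multimatroid.cls Q a ≡ ω × a ∈ A) →
    (∀ (ω : Fin k) → MinorClass Q A ω ⇔ ClassDisjoint Q X ω) ×
    (∀ (u : Fin n) → InMinorGround Q A u ⇔ u ∉ X) ×
    (∀ (S : Subset n) → IsSubtransversal (Multimatroid.cls Q) S →
    S ⊆ ∁ X → minorRank Q A S ≡ Multimatroid.r Q S)
lemma11 Q X A separator@(unionX , _) transA A⊆X meetsA =
    classes , ground , minorRank-across-separator Q separator transA A⊆X
  where
  open Multimatroid Q using (cls)
  open Function.Bundles.Equivalence using (to; from)

  classes : ∀ ω → MinorClass Q A ω ⇔ ClassDisjoint Q X ω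
  classes = avoidsA⇔avoidsX Q unionX A⊆X meetsA

  ground : ∀ u → InMinorGround Q A u ⇔ u ∉ X
  ground u = mk⇔ (λ inGround → to (classDisjoint⇔∉ Q unionX u) (to (classes (cls u)) inGround))
                 (λ u∉X → from (classes (cls u)) (from (classDisjoint⇔∉ Q unionX u) u∉X))
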